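{- For all $n \ge 1$ and $m \ge 1$ there is a bijection between the set of pairs $(T,w)$, where $T$ is a Cayley tree of size $n$ with exactly $m$ ascending runs and $w$ is a node of $T$, and the set of $n$-mappings with exactly $m$ ascending runs.
   Context: A Cayley tree of size $n$ is an unordered rooted tree on $n$ nodes labelled by distinct elements of $[n]$, with edges oriented from child to parent. An $n$-mapping is a function $f:[n]\to[n]$. An ascending run in an $n$-mapping $f$ is a maximal ascending sequence $i < f(i) < \dots < f^k(i)$; the number of ascending runs of $f$ equals the number of $j\in[n]$ such that every $i$ with $f(i)=j$ satisfies $i \ge j$. In a Cayley tree an ascending run is a maximal path towards the root with increasing labels; the number of ascending runs equals the number of nodes $v$ all of whose children have labels larger than $v$. -}

module Defs where

open import Data.Nat using (ℕ; zero; suc; _+_)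
open import Data.Bool using (Bool; true; false; _∧_; if_then_else_)
open import Data.Fin using (Fin; zero; suc; _≤?_; _<?_)
open import Data.Maybe using (Maybe; just; nothing)
open import Data.Vec using (Vec; lookup)
open import Data.Product using (Σ; _,_)
open import Relation.Binary.PropositionalEquality using (_≡_)
open import Relation.Nullary.Decidable using (⌊_⌋)

-- Labels [n] are represented by Fin n (label k+1 ↦ k); the order is preserved.

count : {n : ℕ} → (Fin n → Bool) → ℕ
count {zero} P = 0
count {suc n} P = (if P zero then 1 else 0) + count (λ i → P (suc i))

allF : {n : ℕ} → (Fin n → Bool) → Bool
allF {zero} P = true
allF {suc n} P = P zero ∧ allF (λ i → P (suc i))

Mapping : ℕ → Set
Mapping n = Vec (Fin n) n

mapRuns : {n : ℕ} → Mapping n → ℕ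
mapRuns {n} f =
  count (λ j → allF (λ i → if ⌊ lookup f i Data.Fin.≟ j ⌋ then ⌊ j ≤? i ⌋ else true))

-- Cayley trees: rooted labelled trees on [n], given by the parent map
-- (nothing = the node is the root; edges oriented child → parent).

ParentMap : ℕ → Set
ParentMap n = Vec (Maybe (Fin n)) n

climb : {n : ℕ} → ParentMap n → ℕ → Maybe (Fin n) → Bool
climb p k nothing = true
climb p zero (just i) = false
climb p (suc k) (just i) = climb p k (lookup p i)

isRoot : {n : ℕ} → ParentMap n → Fin n → Bool
isRoot p i with lookup p i
... | nothing = true
... | just _  = false

-- exactly one root, and every node reaches the root (no cycles)
isCayley : {n : ℕ} → ParentMap n → Bool
isCayley {n} p = ⌊ count (isRoot p) Data.Nat.≟ 1 ⌋ ∧ allF (λ i → climb p n (just i))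

CayleyTree : ℕ → Set
CayleyTree n = Σ (ParentMap n) (λ p → isCayley p ≡ true)

isChildOf : {n : ℕ} → ParentMap n → Fin n → Fin n → Bool
isChildOf p i v with lookup p i
... | nothing = false
... | just u  = ⌊ u Data.Fin.≟ v ⌋

treeRuns : {n : ℕ} → CayleyTree n → ℕ
treeRuns {n} (p , _) =
  count (λ v → allF (λ i → if isChildOf p i v then ⌊ v <? i ⌋ else true))

module Submission where

-- Let T be a Cayley tree, w a node, and w = x₀, x₁, …, x_k = root the path
-- from w to the root.  Cut the path just before each new path minimum (each xᵢ
-- smaller than x₀, …, x_{i-1}); the mapping Φ(T, w) turns every segment into a
-- cycle, sending its last node back to its first node, and sends every other
-- node to its parent.  Conversely Ψ(f) breaks every cycle of f just before its
-- least element (its leader) and chains the cycles, by decreasing leader, into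
-- a path ending at the root; the marked node is the greatest leader.  Only the
-- edges entering path minima change, and their new sources are still at least
-- as large, so Φ preserves the number of ascending runs.

open import Defs
open import Data.Nat as ℕ using (ℕ; zero; suc; z≤n; s≤s; _+_; _*_; _≤_; _<_; _≥_)
import Data.Nat.Properties as ℕP
open import Data.Nat.Properties using (anyUpTo?)
open import Data.Nat.Induction using (<-rec)
open import Data.Bool as Bool using (Bool; true; false; _∧_; if_then_else_)
open import Data.Fin as F using (Fin; zero; suc; toℕ)
import Data.Fin.Properties as FP
open import Data.Maybe as Maybe using (Maybe; just; nothing; fromMaybe)
open import Data.Maybe.Properties using (just-injective; ≡-dec)
open import Data.Vec using (lookup; tabulate)
open import Data.Vec.Properties using (lookup∘tabulate; tabulate∘lookup; tabulate-cong)
open import Data.Product using (Σ; _,_; _×_; proj₁; proj₂; ∃; ∃₂)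
open import Data.Sum using (_⊎_; inj₁; inj₂)
open import Data.Empty using (⊥; ⊥-elim)
open import Function using (_∘_)
open import Function.Bundles using (_⤖_; mk↔ₛ′)
open import Function.Properties.Inverse using (↔⇒⤖)
open import Relation.Nullary using (Dec; yes; no; ¬_; Irrelevant)
open import Relation.Nullary.Decidable using (⌊_⌋)
open import Relation.Binary.PropositionalEquality
open import Axiom.UniquenessOfIdentityProofs using (module Decidable⇒UIP)

⌊⌋-sound : ∀ {A : Set} (d : Dec A) → ⌊ d ⌋ ≡ true → A
⌊⌋-sound (yes a) _ = a

⌊⌋-complete : ∀ {A : Set} (d : Dec A) → A → ⌊ d ⌋ ≡ true
⌊⌋-complete (yes _) _ = refl
⌊⌋-complete (no ¬a) a = ⊥-elim (¬a a)

⌊⌋-cong : ∀ {A B : Set} → (A → B) → (B → A) → (a : Dec A) (b : Dec B) → ⌊ a ⌋ ≡ ⌊ b ⌋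
⌊⌋-cong A→B B→A (yes a) (yes b) = refl
⌊⌋-cong A→B B→A (yes a) (no ¬b) = ⊥-elim (¬b (A→B a))
⌊⌋-cong A→B B→A (no ¬a) (yes b) = ⊥-elim (¬a (B→A b))
⌊⌋-cong A→B B→A (no ¬a) (no ¬b) = refl

true≢false : true ≡ false → ⊥
true≢false ()

∧-elim : ∀ {a b} → a ∧ b ≡ true → a ≡ true × b ≡ true
∧-elim {true} {true} _ = refl , refl

∧-intro : ∀ {a b} → a ≡ true → b ≡ true → a ∧ b ≡ true
∧-intro refl refl = refl

∧-false : ∀ {a b} → (a ≡ true → b ≡ true → ⊥) → a ∧ b ≡ false
∧-false {true}  {true}  h = ⊥-elim (h refl refl)
∧-false {true}  {false} h = refl
∧-false {false}         h = refl

implies-elim : ∀ {c d} → (if c then d else true) ≡ true → c ≡ true → d ≡ true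
implies-elim {true} e refl = e

implies-intro : ∀ {c d} → (c ≡ true → d ≡ true) → (if c then d else true) ≡ true
implies-intro {true}  h = h refl
implies-intro {false} h = refl

bool-ext : ∀ {a b} → (a ≡ true → b ≡ true) → (b ≡ true → a ≡ true) → a ≡ b
bool-ext {true}  {true}  _ _ = refl
bool-ext {true}  {false} h _ = sym (h refl)
bool-ext {false} {true}  _ h = h refl
bool-ext {false} {false} _ _ = refl

allF-elim : ∀ {n} {P : Fin n → Bool} → allF P ≡ true → ∀ i → P i ≡ true
allF-elim {suc n} {P} h i with P zero in eq
allF-elim {suc n} {P} h zero    | true = eq
allF-elim {suc n} {P} h (suc i) | true = allF-elim {P = P ∘ suc} h i

allF-intro : ∀ {n} {P : Fin n → Bool} → (∀ i → P i ≡ true) → allF P ≡ true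
allF-intro {zero}      h = refl
allF-intro {suc n} {P} h rewrite h zero = allF-intro {P = P ∘ suc} (h ∘ suc)

count-cong : ∀ {n} {P Q : Fin n → Bool} → (∀ i → P i ≡ Q i) → count P ≡ count Q
count-cong {zero}          e = refl
count-cong {suc n} {P} {Q} e rewrite e zero = cong (_ +_) (count-cong (e ∘ suc))

count-zero : ∀ {n} {P : Fin n → Bool} → count P ≡ 0 → ∀ a → P a ≢ true
count-zero {suc n} {P} c a pa with P zero in eq
count-zero {suc n} {P} c zero    pa | false = true≢false (trans (sym pa) eq)
count-zero {suc n} {P} c (suc a) pa | false = count-zero {P = P ∘ suc} c a pa

count-none : ∀ {n} {P : Fin n → Bool} → (∀ a → P a ≡ false) → count P ≡ 0
count-none {zero}      h = refl
count-none {suc n} {P} h rewrite h zero = count-none {P = P ∘ suc} (h ∘ suc)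

count-one-unique : ∀ {n} {P : Fin n → Bool} → count P ≡ 1 →
                   ∀ a b → P a ≡ true → P b ≡ true → a ≡ b
count-one-unique {suc n} {P} c zero zero _ _ = refl
count-one-unique {suc n} {P} c zero (suc b) pa pb rewrite pa =
  ⊥-elim (count-zero {P = P ∘ suc} (ℕP.suc-injective c) b pb)
count-one-unique {suc n} {P} c (suc a) zero pa pb rewrite pb =
  ⊥-elim (count-zero {P = P ∘ suc} (ℕP.suc-injective c) a pa)
count-one-unique {suc n} {P} c (suc a) (suc b) pa pb with P zero
... | true  = ⊥-elim (count-zero {P = P ∘ suc} (ℕP.suc-injective c) a pa)
... | false = cong suc (count-one-unique {P = P ∘ suc} c a b pa pb)

count-one : ∀ {n} {P : Fin n → Bool} a → P a ≡ true →
            (∀ b → P b ≡ true → b ≡ a) → count P ≡ 1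
count-one {suc n} {P} zero pa h rewrite pa = cong suc (count-none {P = P ∘ suc} others)
  where
  others : ∀ b → P (suc b) ≡ false
  others b with P (suc b) in eq
  ... | true  with () ← h (suc b) eq
  ... | false = refl
count-one {suc n} {P} (suc a) pa h with P zero in eq
... | true  with () ← h zero eq
... | false = count-one {P = P ∘ suc} a pa (λ b pb → FP.suc-injective (h (suc b) pb))

IsLeast : ∀ {n} → (Fin n → Bool) → Fin n → Set
IsLeast P a = P a ≡ true × (∀ b → P b ≡ true → a F.≤ b)

IsGreatest : ∀ {n} → (Fin n → Bool) → Fin n → Set
IsGreatest P a = P a ≡ true × (∀ b → P b ≡ true → b F.≤ a)

least : ∀ {n} → (Fin n → Bool) → Maybe (Fin n)
least {zero}  P = nothing
least {suc n} P = if P zero then just zero else Maybe.map suc (least (P ∘ suc))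

least-sound : ∀ {n} {P : Fin n → Bool} {a} → least P ≡ just a → IsLeast P a
least-sound {suc n} {P} e with P zero in eq
least-sound {suc n} {P} refl | true = eq , λ _ _ → z≤n
least-sound {suc n} {P} e    | false with least (P ∘ suc) in eq′
least-sound {suc n} {P} refl | false | just a with least-sound {P = P ∘ suc} eq′
... | pa , minimal = pa , minimal′
  where
  minimal′ : ∀ b → P b ≡ true → suc a F.≤ b
  minimal′ zero    pb = ⊥-elim (true≢false (trans (sym pb) eq))
  minimal′ (suc b) pb = s≤s (minimal b pb)

least-exists : ∀ {n} {P : Fin n → Bool} a → P a ≡ true → ∃ λ l → least P ≡ just l
least-exists {suc n} {P} a pa with P zero in eq
... | true = zero , refl
least-exists {suc n} {P} zero    pa | false = ⊥-elim (true≢false (trans (sym pa) eq))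
least-exists {suc n} {P} (suc a) pa | false with least-exists {P = P ∘ suc} a pa
... | l , e rewrite e = suc l , refl

least-spec : ∀ {n} {P : Fin n → Bool} a → P a ≡ true → ∃ λ l → least P ≡ just l × IsLeast P l
least-spec {P = P} a pa with least-exists {P = P} a pa
... | l , e = l , e , least-sound e

least-unique : ∀ {n} {P : Fin n → Bool} {a} → IsLeast P a → least P ≡ just a
least-unique {P = P} {a} (pa , min) with least-spec {P = P} a pa
... | l , e , (pl , minl) = trans e (cong just (FP.≤-antisym (minl a pa) (min l pl)))

greatest : ∀ {n} → (Fin n → Bool) → Maybe (Fin n)
greatest {zero}  P = nothing
greatest {suc n} P = prefer (greatest (P ∘ suc)) (P zero)
  where
  prefer : Maybe (Fin n) → Bool → Maybe (Fin (suc n))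
  prefer (just a) _     = just (suc a)
  prefer nothing  true  = just zero
  prefer nothing  false = nothing

greatest-nothing : ∀ {n} {P : Fin n → Bool} → greatest P ≡ nothing → ∀ b → P b ≡ false
greatest-nothing {suc n} {P} e b with greatest (P ∘ suc) in eq′ | P zero in eq
greatest-nothing {suc n} {P} e zero    | nothing | false = eq
greatest-nothing {suc n} {P} e (suc b) | nothing | false = greatest-nothing {P = P ∘ suc} eq′ b

greatest-none : ∀ {n} {P : Fin n → Bool} → (∀ b → P b ≡ false) → greatest P ≡ nothing
greatest-none {zero}      h = refl
greatest-none {suc n} {P} h rewrite greatest-none {P = P ∘ suc} (h ∘ suc) | h zero = refl

greatest-sound : ∀ {n} {P : Fin n → Bool} {a} → greatest P ≡ just a → IsGreatest P a
greatest-sound {suc n} {P} e with greatest (P ∘ suc) in eq′ | P zero in eq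
greatest-sound {suc n} {P} refl | just a | _ with greatest-sound {P = P ∘ suc} eq′
... | pa , maximal = pa , maximal′
  where
  maximal′ : ∀ b → P b ≡ true → b F.≤ suc a
  maximal′ zero    _  = z≤n
  maximal′ (suc b) pb = s≤s (maximal b pb)
greatest-sound {suc n} {P} refl | nothing | true = eq , maximal
  where
  maximal : ∀ b → P b ≡ true → b F.≤ zero {n}
  maximal zero    _  = z≤n
  maximal (suc b) pb = ⊥-elim (true≢false (trans (sym pb) (greatest-nothing {P = P ∘ suc} eq′ b)))

greatest-spec : ∀ {n} {P : Fin n → Bool} a → P a ≡ true → ∃ λ g → greatest P ≡ just g × IsGreatest P g
greatest-spec {P = P} a pa with greatest P in eq
... | just g  = g , refl , greatest-sound eq
... | nothing = ⊥-elim (true≢false (trans (sym pa) (greatest-nothing {P = P} eq a)))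

greatest-unique : ∀ {n} {P : Fin n → Bool} {a} → IsGreatest P a → greatest P ≡ just a
greatest-unique {P = P} {a} (pa , max) with greatest-spec {P = P} a pa
... | g , e , (pg , maxg) = trans e (cong just (FP.≤-antisym (max g pg) (maxg a pa)))

least-cong : ∀ {n} {P Q : Fin n → Bool} → (∀ i → P i ≡ Q i) → least P ≡ least Q
least-cong {zero}          h = refl
least-cong {suc n} {P} {Q} h rewrite h zero | least-cong {P = P ∘ suc} {Q ∘ suc} (h ∘ suc) = refl

greatest-cong : ∀ {n} {P Q : Fin n → Bool} → (∀ i → P i ≡ Q i) → greatest P ≡ greatest Q
greatest-cong {zero}          h = refl
greatest-cong {suc n} {P} {Q} h rewrite h zero | greatest-cong {P = P ∘ suc} {Q ∘ suc} (h ∘ suc) = refl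

-- The functional graph of an endofunction f of Fin n: iterates, orbits and
-- cycles.  Because Fin n is finite, every question about orbits can be
-- decided by a search bounded by n.
module Iteration {n : ℕ} (f : Fin n → Fin n) where

  iter : ℕ → Fin n → Fin n
  iter zero    x = x
  iter (suc k) x = f (iter k x)

  iter-+ : ∀ a b x → iter (a + b) x ≡ iter a (iter b x)
  iter-+ zero    b x = refl
  iter-+ (suc a) b x = cong f (iter-+ a b x)

  iter-suc : ∀ k x → iter (suc k) x ≡ iter k (f x)
  iter-suc k x = trans (cong (λ m → iter m x) (ℕP.+-comm 1 k)) (iter-+ k 1 x)

  iter-period : ∀ {c x} m → iter c x ≡ x → iter (m * c) x ≡ x
  iter-period zero    e = refl
  iter-period {c} {x} (suc m) e = trans (iter-+ c (m * c) x) (trans (cong (iter c) (iter-period m e)) e)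

  Reaches : Fin n → Fin n → Set
  Reaches x y = ∃ λ k → iter k x ≡ y

  Cyclic : Fin n → Set
  Cyclic x = ∃ λ k → iter (suc k) x ≡ x

  Reaches-trans : ∀ {x y z} → Reaches x y → Reaches y z → Reaches x z
  Reaches-trans {x} (a , refl) (b , refl) = b + a , iter-+ b a x

  Reaches-sym : ∀ {x y} → Cyclic x → Reaches x y → Reaches y x
  Reaches-sym {x} (c , ec) (k , refl) = c * k , (begin
      iter (c * k) (iter k x)  ≡⟨ iter-+ (c * k) k x ⟨
      iter (c * k + k) x       ≡⟨ cong (λ m → iter m x) (trans (ℕP.+-comm (c * k) k) (ℕP.*-comm (suc c) k)) ⟩
      iter (k * suc c) x       ≡⟨ iter-period k ec ⟩
      x                        ∎)
    where open ≡-Reasoning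

  Cyclic-f : ∀ {x} → Cyclic x → Cyclic (f x)
  Cyclic-f {x} (k , e) = k , trans (sym (iter-suc (suc k) x)) (cong f e)

  Cyclic-iter : ∀ {x} → Cyclic x → ∀ j → Cyclic (iter j x)
  Cyclic-iter c zero    = c
  Cyclic-iter c (suc j) = Cyclic-f (Cyclic-iter c j)

  Cyclic-reach : ∀ {x y} → Cyclic x → Reaches x y → Cyclic y
  Cyclic-reach c (k , refl) = Cyclic-iter c k

  cyclic-injective : ∀ {x x′} → Cyclic x → Cyclic x′ → f x ≡ f x′ → x ≡ x′
  cyclic-injective {x} {x′} (a , ea) (b , eb) e = begin
      x                        ≡⟨ iter-period {suc a} (suc b) ea ⟨
      iter (suc b * suc a) x   ≡⟨ iter-suc (a + b * suc a) x ⟩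
      iter (a + b * suc a) (f x)  ≡⟨ cong (iter (a + b * suc a)) e ⟩
      iter (a + b * suc a) (f x′) ≡⟨ iter-suc (a + b * suc a) x′ ⟨
      iter (suc b * suc a) x′  ≡⟨ cong (λ z → iter z x′) (ℕP.*-comm (suc b) (suc a)) ⟩
      iter (suc a * suc b) x′  ≡⟨ iter-period {suc b} (suc a) eb ⟩
      x′                       ∎
    where open ≡-Reasoning

  iter-mod-period : ∀ {x k} → iter (suc k) x ≡ x → ∀ t → ∃ λ j → j < suc k × iter t x ≡ iter j x
  iter-mod-period e zero = 0 , s≤s z≤n , refl
  iter-mod-period {x} {k} e (suc t) with iter-mod-period e t
  ... | j , j<k , ej with suc j ℕ.<? suc k
  ... | yes j+1<k = suc j , j+1<k , cong f ej
  ... | no  j+1≮k = 0 , s≤s z≤n , trans (cong f ej) (trans (cong (λ m → iter m x) j+1≡k) e)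
    where
    j+1≡k : suc j ≡ suc k
    j+1≡k = ℕP.≤-antisym j<k (ℕP.≮⇒≥ j+1≮k)

  repeat-within : ∀ x → ∃₂ λ i d → 1 ≤ d × i + d ≤ n × iter (i + d) x ≡ iter i x
  repeat-within x with FP.pigeonhole (ℕP.n<1+n n) (λ (i : Fin (suc n)) → iter (toℕ i) x)
  ... | i , j , i<j , e with ℕP.m≤n⇒∃[o]m+o≡n (ℕP.<⇒≤ i<j)
  ... | d , i+d≡j = toℕ i , d , 1≤d , i+d≤n , trans (cong (λ m → iter m x) i+d≡j) (sym e)
    where
    1≤d : 1 ≤ d
    1≤d = ℕP.n≢0⇒n>0 λ { refl → ℕP.<-irrefl (trans (sym (ℕP.+-identityʳ (toℕ i))) i+d≡j) i<j }
    i+d≤n : toℕ i + d ≤ n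
    i+d≤n = subst (_≤ n) (sym i+d≡j) (ℕ.s≤s⁻¹ (FP.toℕ<n j))

  shortcut : ∀ x k → n ≤ k → ∃₂ λ k′ d → k ≡ k′ + d × 1 ≤ d × d ≤ n × iter k x ≡ iter k′ x
  shortcut x k n≤k with repeat-within x
  ... | i , d , 1≤d , i+d≤n , e = (k ℕ.∸ j) + i , d , k≡k′+d , 1≤d , ℕP.≤-trans (ℕP.m≤n+m d i) i+d≤n , iter-eq
    where
    j : ℕ
    j = i + d
    j≤k : j ≤ k
    j≤k = ℕP.≤-trans i+d≤n n≤k
    k≡k′+d : k ≡ (k ℕ.∸ j) + i + d
    k≡k′+d = sym (trans (ℕP.+-assoc (k ℕ.∸ j) i d) (ℕP.m∸n+n≡m j≤k))
    iter-eq : iter k x ≡ iter ((k ℕ.∸ j) + i) x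
    iter-eq = begin
      iter k x                  ≡⟨ cong (λ m → iter m x) (ℕP.m∸n+n≡m j≤k) ⟨
      iter ((k ℕ.∸ j) + j) x    ≡⟨ iter-+ (k ℕ.∸ j) j x ⟩
      iter (k ℕ.∸ j) (iter j x) ≡⟨ cong (iter (k ℕ.∸ j)) e ⟩
      iter (k ℕ.∸ j) (iter i x) ≡⟨ iter-+ (k ℕ.∸ j) i x ⟨
      iter ((k ℕ.∸ j) + i) x    ∎
      where open ≡-Reasoning

  reach-bound : ∀ {x y} → Reaches x y → ∃ λ k → k < n × iter k x ≡ y
  reach-bound {x} {y} (k , e) = <-rec Goal shorten k e
    where
    Goal : ℕ → Set
    Goal k = iter k x ≡ y → ∃ λ k → k < n × iter k x ≡ y
    shorten : ∀ k → (∀ {k′} → k′ < k → Goal k′) → Goal k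
    shorten k rec e with k ℕ.<? n
    ... | yes k<n = k , k<n , e
    ... | no  k≮n with shortcut x k (ℕP.≮⇒≥ k≮n)
    ... | k′ , d , refl , 1≤d , _ , e′ = rec (ℕP.m<m+n k′ 1≤d) (trans (sym e′) e)

  cycle-bound : ∀ {x} → Cyclic x → ∃ λ k → k < n × iter (suc k) x ≡ x
  cycle-bound {x} (k , e) with reach-bound (k , trans (sym (iter-suc k x)) e)
  ... | k′ , k′<n , e′ = k′ , k′<n , trans (iter-suc k′ x) e′

  first-visit : ∀ {x y} → Reaches x y → ∃ λ k → iter k x ≡ y × (∀ i → i < k → iter (suc i) x ≢ x)
  first-visit {x} {y} (k , e) = <-rec Goal shorten k e
    where
    Goal : ℕ → Set
    Goal k = iter k x ≡ y → ∃ λ k → iter k x ≡ y × (∀ i → i < k → iter (suc i) x ≢ x)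
    shorten : ∀ k → (∀ {k′} → k′ < k → Goal k′) → Goal k
    shorten k rec e with anyUpTo? (λ i → iter (suc i) x F.≟ x) k
    ... | no  no-return = k , e , λ i i<k ret → no-return (i , i<k , ret)
    ... | yes (i , i<k , ret) with ℕP.m≤n⇒∃[o]m+o≡n i<k
    ... | r , i+1+r≡k = rec r<k (trans (sym skip-loop) e)
      where
      r<k : r < k
      r<k = subst (r <_) i+1+r≡k (ℕP.m<n+m r (s≤s z≤n))
      skip-loop : iter k x ≡ iter r x
      skip-loop = begin
        iter k x                ≡⟨ cong (λ m → iter m x) (trans (sym i+1+r≡k) (ℕP.+-comm (suc i) r)) ⟩
        iter (r + suc i) x      ≡⟨ iter-+ r (suc i) x ⟩
        iter r (iter (suc i) x) ≡⟨ cong (iter r) ret ⟩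
        iter r x                ∎
        where open ≡-Reasoning

-- Every cycle is led by its least element.  Ψ(f) keeps every edge x ↦ f x
-- except those entering a leader; such an edge is redirected to the next
-- smaller leader, and the edge entering the least leader is removed, its
-- source becoming the root.
module CycleStructure {n : ℕ} (f : Fin n → Fin n) where

  open Iteration f public

  cyclic? : Fin n → Bool
  cyclic? x = ⌊ anyUpTo? (λ k → iter (suc k) x F.≟ x) n ⌋

  cyclic?-sound : ∀ {x} → cyclic? x ≡ true → Cyclic x
  cyclic?-sound {x} e with (k , _ , q) ← ⌊⌋-sound (anyUpTo? (λ k → iter (suc k) x F.≟ x) n) e = k , q

  cyclic?-complete : ∀ {x} → Cyclic x → cyclic? x ≡ true
  cyclic?-complete {x} c = ⌊⌋-complete (anyUpTo? (λ k → iter (suc k) x F.≟ x) n) (cycle-bound c)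

  cyclic?-false : ∀ {x} → cyclic? x ≡ false → ¬ Cyclic x
  cyclic?-false e c = true≢false (trans (sym (cyclic?-complete c)) e)

  reaches? : Fin n → Fin n → Bool
  reaches? x y = ⌊ anyUpTo? (λ k → iter k x F.≟ y) n ⌋

  reaches?-sound : ∀ {x y} → reaches? x y ≡ true → Reaches x y
  reaches?-sound {x} {y} e with (k , _ , q) ← ⌊⌋-sound (anyUpTo? (λ k → iter k x F.≟ y) n) e = k , q

  reaches?-complete : ∀ {x y} → Reaches x y → reaches? x y ≡ true
  reaches?-complete {x} {y} r = ⌊⌋-complete (anyUpTo? (λ k → iter k x F.≟ y) n) (reach-bound r)

  orbitMin : Fin n → Fin n
  orbitMin x = fromMaybe x (least (reaches? x))

  IsOrbitMin : Fin n → Fin n → Set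
  IsOrbitMin x h = Reaches x h × (∀ y → Reaches x y → h F.≤ y)

  orbitMin-spec : ∀ x → IsOrbitMin x (orbitMin x)
  orbitMin-spec x with least-spec {P = reaches? x} x (reaches?-complete (0 , refl))
  ... | l , e , (pl , minimal) rewrite e =
    reaches?-sound pl , λ y r → minimal y (reaches?-complete r)

  orbitMin-unique : ∀ {x h} → IsOrbitMin x h → orbitMin x ≡ h
  orbitMin-unique {x} (r , minimal)
    rewrite least-unique {P = reaches? x} (reaches?-complete r , λ y q → minimal y (reaches?-sound q)) = refl

  orbitMin≤ : ∀ x → orbitMin x F.≤ x
  orbitMin≤ x = proj₂ (orbitMin-spec x) x (0 , refl)

  orbitMin-reach : ∀ {x y} → Cyclic x → Reaches x y → orbitMin y ≡ orbitMin x
  orbitMin-reach {x} c r = orbitMin-unique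
    ( Reaches-trans (Reaches-sym c r) (proj₁ (orbitMin-spec x))
    , λ z q → proj₂ (orbitMin-spec x) z (Reaches-trans r q))

  orbitMin-f : ∀ {x} → Cyclic x → orbitMin (f x) ≡ orbitMin x
  orbitMin-f c = orbitMin-reach c (1 , refl)

  isLeader : Fin n → Bool
  isLeader x = cyclic? x ∧ ⌊ orbitMin x F.≟ x ⌋

  Leader : Fin n → Set
  Leader x = Cyclic x × orbitMin x ≡ x

  isLeader-sound : ∀ {x} → isLeader x ≡ true → Leader x
  isLeader-sound {x} e with ∧-elim e
  ... | c , m = cyclic?-sound c , ⌊⌋-sound (orbitMin x F.≟ x) m

  isLeader-complete : ∀ {x} → Leader x → isLeader x ≡ true
  isLeader-complete {x} (c , m) = ∧-intro (cyclic?-complete c) (⌊⌋-complete (orbitMin x F.≟ x) m)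

  leader-orbitMin : ∀ {x} → Cyclic x → isLeader (orbitMin x) ≡ true
  leader-orbitMin {x} c = isLeader-complete (Cyclic-reach c r , orbitMin-reach c r)
    where
    r : Reaches x (orbitMin x)
    r = proj₁ (orbitMin-spec x)

  leader-fixed : ∀ {x} → isLeader x ≡ true → orbitMin x ≡ x
  leader-fixed l = proj₂ (isLeader-sound l)

  leader-unique : ∀ {m z} → isLeader m ≡ true → Reaches m z → isLeader z ≡ true → z ≡ m
  leader-unique lm r lz with isLeader-sound lm | isLeader-sound lz
  ... | (c , em) | (_ , ez) = trans (sym ez) (trans (orbitMin-reach c r) em)

  enters-leader : ∀ {x k} → iter (suc k) x ≡ x → ∃ λ j → j < suc k × f (iter j x) ≡ orbitMin x
  enters-leader {x} {k} returns with proj₁ (orbitMin-spec x)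
  ... | t , reach with iter-mod-period returns t
  ... | zero  , _   , same = k , ℕP.n<1+n k , trans returns (trans (sym same) reach)
  ... | suc j , j<k , same = j , ℕP.<-trans (ℕP.n<1+n j) j<k , trans (sym same) reach

  prevLeader : Fin n → Maybe (Fin n)
  prevLeader m = greatest (λ y → isLeader y ∧ ⌊ y F.<? m ⌋)

  prevLeader-sound : ∀ {m y} → prevLeader m ≡ just y → isLeader y ≡ true × y F.< m
  prevLeader-sound {m} {y} e with ∧-elim (proj₁ (greatest-sound e))
  ... | l , lt = l , ⌊⌋-sound (y F.<? m) lt

  prevLeader-none : ∀ {m z} → prevLeader m ≡ nothing → isLeader z ≡ true → ¬ (z F.< m)
  prevLeader-none {m} {z} e lz z<m =
    true≢false (trans (sym (∧-intro lz (⌊⌋-complete (z F.<? m) z<m))) (greatest-nothing e z))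

  prevLeader-successor : ∀ {m m′} → isLeader m ≡ true → m F.< m′ →
                         (∀ b → isLeader b ≡ true → m F.< b → m′ F.≤ b) → prevLeader m′ ≡ just m
  prevLeader-successor {m} {m′} l m<m′ least-above =
    greatest-unique {P = λ y → isLeader y ∧ ⌊ y F.<? m′ ⌋} (∧-intro l (⌊⌋-complete (m F.<? m′) m<m′) , below)
    where
    below : ∀ b → (isLeader b ∧ ⌊ b F.<? m′ ⌋) ≡ true → b F.≤ m
    below b e with ∧-elim {isLeader b} e
    ... | lb , b<m′ = ℕP.≮⇒≥ λ m<b → ℕP.<⇒≱ (⌊⌋-sound (b F.<? m′) b<m′) (least-above b lb m<b)

  parentΨ : Fin n → Maybe (Fin n)
  parentΨ x = if cyclic? x ∧ isLeader (f x) then prevLeader (f x) else just (f x)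

  data ParentΨView (x : Fin n) : Set where
    acyclic-edge : ¬ Cyclic x → parentΨ x ≡ just (f x) → ParentΨView x
    cycle-edge   : Cyclic x → isLeader (f x) ≡ false → parentΨ x ≡ just (f x) → ParentΨView x
    redirected   : Cyclic x → isLeader (f x) ≡ true → parentΨ x ≡ prevLeader (f x) → ParentΨView x

  parentΨ-by : ∀ {x a b} → cyclic? x ≡ a → isLeader (f x) ≡ b →
               parentΨ x ≡ (if a ∧ b then prevLeader (f x) else just (f x))
  parentΨ-by refl refl = refl

  parentΨ-view : ∀ x → ParentΨView x
  parentΨ-view x with cyclic? x in c | isLeader (f x) in l
  ... | false | _     = acyclic-edge (cyclic?-false c) (parentΨ-by c l)
  ... | true  | false = cycle-edge (cyclic?-sound c) l (parentΨ-by c l)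
  ... | true  | true  = redirected (cyclic?-sound c) l (parentΨ-by c l)

  markΨ : Fin n → Fin n
  markΨ default = fromMaybe default (greatest isLeader)

-- Ψ(f) only depends on the values of f.  Needed because the inverse map is
-- applied to the stored vector `tabulate Φ`, whose lookups only agree with Φ
-- pointwise.
module _ {n} {f g : Fin n → Fin n} (f≗g : ∀ x → f x ≡ g x) where
  private
    module A = CycleStructure f
    module B = CycleStructure g

  iter-cong : ∀ k x → A.iter k x ≡ B.iter k x
  iter-cong zero    x = refl
  iter-cong (suc k) x = trans (f≗g _) (cong g (iter-cong k x))

  cyclic?-cong : ∀ x → A.cyclic? x ≡ B.cyclic? x
  cyclic?-cong x = ⌊⌋-cong
    (λ (k , k<n , e) → k , k<n , trans (sym (iter-cong (suc k) x)) e)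
    (λ (k , k<n , e) → k , k<n , trans (iter-cong (suc k) x) e)
    (anyUpTo? (λ k → A.iter (suc k) x F.≟ x) n) (anyUpTo? (λ k → B.iter (suc k) x F.≟ x) n)

  reaches?-cong : ∀ x y → A.reaches? x y ≡ B.reaches? x y
  reaches?-cong x y = ⌊⌋-cong
    (λ (k , k<n , e) → k , k<n , trans (sym (iter-cong k x)) e)
    (λ (k , k<n , e) → k , k<n , trans (iter-cong k x) e)
    (anyUpTo? (λ k → A.iter k x F.≟ y) n) (anyUpTo? (λ k → B.iter k x F.≟ y) n)

  isLeader-cong : ∀ x → A.isLeader x ≡ B.isLeader x
  isLeader-cong x = cong₂ _∧_ (cyclic?-cong x) (cong (λ m → ⌊ m F.≟ x ⌋) orbitMin-eq)
    where
    orbitMin-eq : A.orbitMin x ≡ B.orbitMin x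
    orbitMin-eq = cong (fromMaybe x) (least-cong (reaches?-cong x))

  prevLeader-cong : ∀ m → A.prevLeader m ≡ B.prevLeader m
  prevLeader-cong m = greatest-cong λ y → cong (_∧ ⌊ y F.<? m ⌋) (isLeader-cong y)

  parentΨ-cong : ∀ x → A.parentΨ x ≡ B.parentΨ x
  parentΨ-cong x = begin
      A.parentΨ x
        ≡⟨ cong₂ (λ c l → if c ∧ l then A.prevLeader (f x) else just (f x)) (cyclic?-cong x) (isLeader-cong (f x)) ⟩
      (if B.cyclic? x ∧ B.isLeader (f x) then A.prevLeader (f x) else just (f x))
        ≡⟨ cong (λ p → if B.cyclic? x ∧ B.isLeader (f x) then p else just (f x)) (prevLeader-cong (f x)) ⟩
      (if B.cyclic? x ∧ B.isLeader (f x) then B.prevLeader (f x) else just (f x))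
        ≡⟨ cong (λ y → if B.cyclic? x ∧ B.isLeader y then B.prevLeader y else just y) (f≗g x) ⟩
      B.parentΨ x
        ∎
    where open ≡-Reasoning

  markΨ-cong : ∀ d → A.markΨ d ≡ B.markΨ d
  markΨ-cong d = cong (fromMaybe d) (greatest-cong isLeader-cong)

just≢nothing : ∀ {A : Set} {a : A} → just a ≢ nothing
just≢nothing ()

module Ancestry {n : ℕ} (P : ParentMap n) where

  parent : Fin n → Maybe (Fin n)
  parent = lookup P

  up : Maybe (Fin n) → Maybe (Fin n)
  up nothing  = nothing
  up (just i) = parent i

  climbs : ℕ → Maybe (Fin n) → Maybe (Fin n)
  climbs zero    m = m
  climbs (suc k) m = climbs k (up m)

  climbs-nothing : ∀ k → climbs k nothing ≡ nothing
  climbs-nothing zero    = refl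
  climbs-nothing (suc k) = climbs-nothing k

  climb-sound : ∀ k m → climb P k m ≡ true → climbs k m ≡ nothing
  climb-sound k       nothing  e = climbs-nothing k
  climb-sound (suc k) (just i) e = climb-sound k (parent i) e

  climb-complete : ∀ k m → climbs k m ≡ nothing → climb P k m ≡ true
  climb-complete k       nothing  e = refl
  climb-complete (suc k) (just i) e = climb-complete k (parent i) e

  climbs-+ : ∀ a b m → climbs (a + b) m ≡ climbs b (climbs a m)
  climbs-+ zero    b m = refl
  climbs-+ (suc a) b m = climbs-+ a b (up m)

  climbs-suc : ∀ k m → climbs (suc k) m ≡ up (climbs k m)
  climbs-suc k m = trans (cong (λ z → climbs z m) (ℕP.+-comm 1 k)) (climbs-+ k 1 m)

  climbs-mono : ∀ {a b} m → climbs a m ≡ nothing → a ≤ b → climbs b m ≡ nothing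
  climbs-mono {a} {b} m e a≤b = begin
      climbs b m                       ≡⟨ cong (λ z → climbs z m) (ℕP.m+[n∸m]≡n a≤b) ⟨
      climbs (a + (b ℕ.∸ a)) m         ≡⟨ climbs-+ a (b ℕ.∸ a) m ⟩
      climbs (b ℕ.∸ a) (climbs a m)    ≡⟨ cong (climbs (b ℕ.∸ a)) e ⟩
      climbs (b ℕ.∸ a) nothing         ≡⟨ climbs-nothing (b ℕ.∸ a) ⟩
      nothing                          ∎
    where open ≡-Reasoning

  climbs-just : ∀ {a b} m y → climbs b m ≡ just y → a ≤ b → ∃ λ z → climbs a m ≡ just z
  climbs-just {a} m y e a≤b with climbs a m in eq
  ... | just z  = z , refl
  ... | nothing = ⊥-elim (just≢nothing (trans (sym e) (climbs-mono m eq a≤b)))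

  climbs-parent : ∀ {k x y} → climbs (suc k) (just x) ≡ just y →
                  ∃ λ z → climbs k (just x) ≡ just z × parent z ≡ just y
  climbs-parent {k} {x} {y} e with climbs-just {k} (just x) y e (ℕP.n≤1+n k)
  ... | z , ez = z , ez , trans (cong up (sym ez)) (trans (sym (climbs-suc k (just x))) e)

  _≼_ : Fin n → Fin n → Set
  a ≼ b = ∃ λ k → climbs k (just a) ≡ just b

  ≼-refl : ∀ {a} → a ≼ a
  ≼-refl = 0 , refl

  ≼-trans : ∀ {a b c} → a ≼ b → b ≼ c → a ≼ c
  ≼-trans {a} (k , e) (l , e′) = k + l , trans (climbs-+ k l (just a)) (trans (cong (climbs l) e) e′)

  ≼-parent : ∀ {a b} → parent a ≡ just b → a ≼ b
  ≼-parent e = 1 , e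

  climbs-≤ : ∀ {w i j a b} → i ≤ j → climbs i (just w) ≡ just a → climbs j (just w) ≡ just b → a ≼ b
  climbs-≤ {w} {i} {j} i≤j ea eb = j ℕ.∸ i , (begin
      climbs (j ℕ.∸ i) (just _)             ≡⟨ cong (climbs (j ℕ.∸ i)) ea ⟨
      climbs (j ℕ.∸ i) (climbs i (just w))  ≡⟨ climbs-+ i (j ℕ.∸ i) (just w) ⟨
      climbs (i + (j ℕ.∸ i)) (just w)       ≡⟨ cong (λ z → climbs z (just w)) (ℕP.m+[n∸m]≡n i≤j) ⟩
      climbs j (just w)                     ≡⟨ eb ⟩
      just _                                ∎)
    where open ≡-Reasoning

  ≼-uncons : ∀ {a b} → a ≼ b → a ≡ b ⊎ ∃ λ c → parent a ≡ just c × c ≼ b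
  ≼-uncons (zero , refl) = inj₁ refl
  ≼-uncons {a} (suc k , e) with parent a in eq
  ... | nothing = ⊥-elim (just≢nothing (trans (sym e) (climbs-nothing k)))
  ... | just c  = inj₂ (c , refl , k , e)

  root-above : ∀ k a → climbs k (just a) ≡ nothing → ∃ λ r → a ≼ r × parent r ≡ nothing
  root-above (suc k) a e with parent a in eq
  ... | nothing = a , ≼-refl , eq
  ... | just b with root-above k b e
  ... | r , b≼r , root = r , ≼-trans (≼-parent eq) b≼r , root

  Acyclic : Set
  Acyclic = ∀ x k → climbs (suc k) (just x) ≢ just x

  acyclic⇒bounded : Acyclic → ∀ x → climbs n (just x) ≡ nothing
  acyclic⇒bounded acyclic x with climbs n (just x) in eqn
  ... | nothing = refl
  ... | just z  = ⊥-elim cycle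
    where
    anc : Fin (suc n) → Fin n
    anc i = fromMaybe x (climbs (toℕ i) (just x))
    anc-spec : ∀ i → climbs (toℕ i) (just x) ≡ just (anc i)
    anc-spec i with climbs-just {toℕ i} (just x) z eqn (ℕ.s≤s⁻¹ (FP.toℕ<n i))
    ... | y , e rewrite e = refl
    cycle : ⊥
    cycle with FP.pigeonhole (ℕP.n<1+n n) anc
    ... | i , j , i<j , e with ℕP.m≤n⇒∃[o]m+o≡n i<j
    ... | d , i+1+d≡j = acyclic (anc i) d (begin
        climbs (suc d) (just (anc i))                ≡⟨ cong (climbs (suc d)) (anc-spec i) ⟨
        climbs (suc d) (climbs (toℕ i) (just x))     ≡⟨ climbs-+ (toℕ i) (suc d) (just x) ⟨
        climbs (toℕ i + suc d) (just x)              ≡⟨ cong (λ m → climbs m (just x)) (trans (ℕP.+-suc (toℕ i) d) i+1+d≡j) ⟩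
        climbs (toℕ j) (just x)                      ≡⟨ anc-spec j ⟩
        just (anc j)                                 ≡⟨ cong just e ⟨
        just (anc i)                                 ∎)
      where open ≡-Reasoning

  module Bounded (bounded : ∀ x → climbs n (just x) ≡ nothing) where

    climbs-<n : ∀ {k x y} → climbs k (just x) ≡ just y → k < n
    climbs-<n {k} {x} e with k ℕ.<? n
    ... | yes k<n = k<n
    ... | no  k≮n = ⊥-elim (just≢nothing (trans (sym e) (climbs-mono (just x) (bounded x) (ℕP.≮⇒≥ k≮n))))

    climbs-period : ∀ {c x} m → climbs c (just x) ≡ just x → climbs (m * c) (just x) ≡ just x
    climbs-period zero    e = refl
    climbs-period {c} {x} (suc m) e =
      trans (climbs-+ c (m * c) (just x)) (trans (cong (climbs (m * c)) e) (climbs-period m e))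

    acyclic : Acyclic
    acyclic x k e = just≢nothing (begin
        just x                              ≡⟨ climbs-period n e ⟨
        climbs (n * suc k) (just x)         ≡⟨ cong (λ z → climbs z (just x)) (ℕP.*-suc n k) ⟩
        climbs (n + n * k) (just x)         ≡⟨ climbs-+ n (n * k) (just x) ⟩
        climbs (n * k) (climbs n (just x))  ≡⟨ cong (climbs (n * k)) (bounded x) ⟩
        climbs (n * k) nothing              ≡⟨ climbs-nothing (n * k) ⟩
        nothing                             ∎)
      where open ≡-Reasoning

    parent-irrefl : ∀ {a} → parent a ≢ just a
    parent-irrefl {a} = acyclic a 0

    ≼-antisym : ∀ {a b} → a ≼ b → b ≼ a → a ≡ b
    ≼-antisym (zero , refl) _ = refl
    ≼-antisym {a} (suc k , e) (l , e′) = ⊥-elim (acyclic a (k + l)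
      (trans (climbs-+ (suc k) l (just a)) (trans (cong (climbs l) e) e′)))

    ≼-linear : ∀ {w a b} → w ≼ a → w ≼ b → a ≼ b ⊎ b ≼ a
    ≼-linear (i , ei) (j , ej) with ℕP.≤-total i j
    ... | inj₁ i≤j = inj₁ (climbs-≤ i≤j ei ej)
    ... | inj₂ j≤i = inj₂ (climbs-≤ j≤i ej ei)

    ≼-between : ∀ {w x y z} → w ≼ x → parent x ≡ just y → w ≼ z → z ≼ y → z ≼ x ⊎ z ≡ y
    ≼-between w≼x x↦y w≼z z≼y with ≼-linear w≼z w≼x
    ... | inj₁ z≼x = inj₁ z≼x
    ... | inj₂ x≼z with ≼-uncons x≼z
    ... | inj₁ refl = inj₁ ≼-refl
    ... | inj₂ (c , x↦c , c≼z) with trans (sym x↦y) x↦c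
    ... | refl = inj₂ (≼-antisym z≼y c≼z)

    ancestor? : Fin n → Fin n → Bool
    ancestor? a b = ⌊ anyUpTo? (λ k → ≡-dec F._≟_ (climbs k (just a)) (just b)) n ⌋

    ancestor?-sound : ∀ {a b} → ancestor? a b ≡ true → a ≼ b
    ancestor?-sound {a} {b} e
      with (k , _ , q) ← ⌊⌋-sound (anyUpTo? (λ k → ≡-dec F._≟_ (climbs k (just a)) (just b)) n) e = k , q

    ancestor?-complete : ∀ {a b} → a ≼ b → ancestor? a b ≡ true
    ancestor?-complete {a} {b} (k , e) =
      ⌊⌋-complete (anyUpTo? (λ k → ≡-dec F._≟_ (climbs k (just a)) (just b)) n) (k , climbs-<n e , e)

    ≼-dec : ∀ a b → a ≼ b ⊎ ¬ a ≼ b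
    ≼-dec a b with ancestor? a b in e
    ... | true  = inj₁ (ancestor?-sound e)
    ... | false = inj₂ λ a≼b → true≢false (trans (sym (ancestor?-complete a≼b)) e)

module _ {n : ℕ} (P : ParentMap n) where
  open Ancestry P

  isRoot-sound : ∀ {x} → isRoot P x ≡ true → parent x ≡ nothing
  isRoot-sound {x} e with parent x
  ... | nothing = refl

  isRoot-complete : ∀ {x} → parent x ≡ nothing → isRoot P x ≡ true
  isRoot-complete {x} e rewrite e = refl

  isChildOf-sound : ∀ {i v} → isChildOf P i v ≡ true → parent i ≡ just v
  isChildOf-sound {i} {v} c with parent i
  ... | just u = cong just (⌊⌋-sound (u F.≟ v) c)

  isChildOf-complete : ∀ {i v} → parent i ≡ just v → isChildOf P i v ≡ true
  isChildOf-complete {i} {v} i↦v rewrite i↦v = ⌊⌋-complete (v F.≟ v) refl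

  cayley-bounded : isCayley P ≡ true → ∀ x → climbs n (just x) ≡ nothing
  cayley-bounded e x = climb-sound n (just x) (allF-elim (proj₂ (∧-elim e)) x)

  cayley-root-unique : isCayley P ≡ true → ∀ a b → parent a ≡ nothing → parent b ≡ nothing → a ≡ b
  cayley-root-unique e a b ra rb = count-one-unique one-root a b (isRoot-complete ra) (isRoot-complete rb)
    where
    one-root : count (isRoot P) ≡ 1
    one-root = ⌊⌋-sound (count (isRoot P) ℕ.≟ 1) (proj₁ (∧-elim e))

  cayley-intro : (r : Fin n) → parent r ≡ nothing → (∀ a b → parent a ≡ nothing → parent b ≡ nothing → a ≡ b) →
                 (∀ x → climbs n (just x) ≡ nothing) → isCayley P ≡ true
  cayley-intro r root unique bounded = ∧-intro
    (⌊⌋-complete (count (isRoot P) ℕ.≟ 1)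
       (count-one r (isRoot-complete root) λ b rb → unique b r (isRoot-sound rb) root))
    (allF-intro λ x → climb-complete n (just x) (bounded x))

-- On the path, x maps to its parent y
-- unless y is smaller than every node between w and x (or x is the root); then
-- x maps back to that minimum instead, closing a cycle.  The cycles of Φ are
-- thus the segments of the path cut just before each new path minimum.
module TreeToMapping {n : ℕ} (P : ParentMap n)
                     (bounded : ∀ x → Ancestry.climbs P n (just x) ≡ nothing)
                     (root-unique : ∀ a b → lookup P a ≡ nothing → lookup P b ≡ nothing → a ≡ b)
                     (w : Fin n) where

  open Ancestry P public
  open Bounded bounded public

  onPath : Fin n → Bool
  onPath = ancestor? w

  between : Fin n → Fin n → Bool
  between x y = ancestor? w y ∧ ancestor? y x

  pathMin : Fin n → Fin n
  pathMin x = fromMaybe x (least (between x))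

  onPathValue : Maybe (Fin n) → Fin n → Fin n
  onPathValue nothing  r = r
  onPathValue (just y) r = if ⌊ y F.<? r ⌋ then r else y

  Φ : Fin n → Fin n
  Φ x = if onPath x then onPathValue (parent x) (pathMin x) else fromMaybe x (parent x)

  Φ-by : ∀ {x a m} → onPath x ≡ a → parent x ≡ m →
         Φ x ≡ (if a then onPathValue m (pathMin x) else fromMaybe x m)
  Φ-by refl refl = refl

  IsPathMin : Fin n → Fin n → Set
  IsPathMin x h = w ≼ h × h ≼ x × (∀ y → w ≼ y → y ≼ x → h F.≤ y)

  pathMin-spec : ∀ {x} → w ≼ x → IsPathMin x (pathMin x)
  pathMin-spec {x} w≼x
    with least-spec {P = between x} x (∧-intro (ancestor?-complete w≼x) (ancestor?-complete ≼-refl))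
  ... | l , e , (bl , minimal) rewrite e with ∧-elim bl
  ... | w≼l , l≼x = ancestor?-sound w≼l , ancestor?-sound l≼x , λ y w≼y y≼x →
        minimal y (∧-intro (ancestor?-complete w≼y) (ancestor?-complete y≼x))

  pathMin-unique : ∀ {x h} → IsPathMin x h → pathMin x ≡ h
  pathMin-unique {x} (w≼h , h≼x , minimal)
    rewrite least-unique {P = between x}
              ( ∧-intro (ancestor?-complete w≼h) (ancestor?-complete h≼x)
              , λ y b → let (w≼y , y≼x) = ∧-elim b in minimal y (ancestor?-sound w≼y) (ancestor?-sound y≼x))
    = refl

  pathMin≤ : ∀ {x} → w ≼ x → pathMin x F.≤ x
  pathMin≤ w≼x = proj₂ (proj₂ (pathMin-spec w≼x)) _ w≼x ≼-refl

  pathMin-idem : ∀ {x} → w ≼ x → pathMin (pathMin x) ≡ pathMin x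
  pathMin-idem w≼x with pathMin-spec w≼x
  ... | w≼h , h≼x , minimal = pathMin-unique (w≼h , ≼-refl , λ y w≼y y≼h → minimal y w≼y (≼-trans y≼h h≼x))

  pathMin-record : ∀ {y} → w ≼ y → (∀ z → w ≼ z → z ≼ y → y F.≤ z) → pathMin y ≡ y
  pathMin-record w≼y minimal = pathMin-unique (w≼y , ≼-refl , minimal)

  onPathValue-< : ∀ {y r} → y F.< r → onPathValue (just y) r ≡ r
  onPathValue-< {y} {r} y<r with y F.<? r
  ... | yes _   = refl
  ... | no  y≮r = ⊥-elim (y≮r y<r)

  onPathValue-≮ : ∀ {y r} → ¬ y F.< r → onPathValue (just y) r ≡ y
  onPathValue-≮ {y} {r} y≮r with y F.<? r
  ... | yes y<r = ⊥-elim (y≮r y<r)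
  ... | no  _   = refl

  data PathStep (x : Fin n) : Set where
    close-at-root : parent x ≡ nothing → Φ x ≡ pathMin x → PathStep x
    close-before  : ∀ y → parent x ≡ just y → y F.< pathMin x → Φ x ≡ pathMin x → PathStep x
    continue      : ∀ y → parent x ≡ just y → ¬ y F.< pathMin x → Φ x ≡ y → PathStep x

  pathStep : ∀ {x} → w ≼ x → PathStep x
  pathStep {x} w≼x = by-parent (parent x) refl
    where
    on : onPath x ≡ true
    on = ancestor?-complete w≼x
    by-parent : ∀ m → parent x ≡ m → PathStep x
    by-parent nothing  px = close-at-root px (Φ-by on px)
    by-parent (just y) px with y F.<? pathMin x
    ... | yes y<m = close-before y px y<m (trans (Φ-by on px) (onPathValue-< y<m))
    ... | no  y≮m = continue y px y≮m (trans (Φ-by on px) (onPathValue-≮ y≮m))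

  root-on-path : ∀ {x} → parent x ≡ nothing → w ≼ x
  root-on-path {x} root with root-above n w (bounded w)
  ... | r , w≼r , root′ rewrite root-unique x r root root′ = w≼r

  Φ-off : ∀ {x} → ¬ w ≼ x → parent x ≡ just (Φ x)
  Φ-off {x} w⋠x = by-parent (parent x) refl
    where
    off : onPath x ≡ false
    off with onPath x in on
    ... | true  = ⊥-elim (w⋠x (ancestor?-sound on))
    ... | false = refl
    by-parent : ∀ m → parent x ≡ m → parent x ≡ just (Φ x)
    by-parent nothing  px = ⊥-elim (w⋠x (root-on-path px))
    by-parent (just y) px = trans px (cong just (sym (Φ-by off px)))

  Φ-path : ∀ {x} → w ≼ x → w ≼ Φ x × pathMin (Φ x) ≡ pathMin x
  Φ-path {x} w≼x with pathStep w≼x | pathMin-spec w≼x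
  ... | close-at-root _ e       | (w≼h , _ , _) rewrite e = w≼h , pathMin-idem w≼x
  ... | close-before _ _ _ e    | (w≼h , _ , _) rewrite e = w≼h , pathMin-idem w≼x
  ... | continue y x↦y y≮h e   | (w≼h , h≼x , minimal) rewrite e =
        ≼-trans w≼x (≼-parent x↦y) , pathMin-unique (w≼h , ≼-trans h≼x (≼-parent x↦y) , minimal′)
    where
    minimal′ : ∀ z → w ≼ z → z ≼ y → pathMin x F.≤ z
    minimal′ z w≼z z≼y with ≼-between w≼x x↦y w≼z z≼y
    ... | inj₁ z≼x = minimal z w≼z z≼x
    ... | inj₂ refl = ℕP.≮⇒≥ y≮h

  open CycleStructure Φ public

  walk-up : ∀ k {x} → climbs k (just x) ≡ nothing → w ≼ x → ∃ λ a → iter (suc a) x ≡ pathMin x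
  walk-up (suc k) {x} e w≼x with pathStep w≼x
  ... | close-at-root _ Φx      = 0 , Φx
  ... | close-before _ _ _ Φx   = 0 , Φx
  ... | continue y x↦y _ Φx
    with walk-up k (subst (λ m → climbs k m ≡ nothing) x↦y e) (≼-trans w≼x (≼-parent x↦y))
  ... | a , ea = suc a , (begin
      iter (suc (suc a)) x  ≡⟨ iter-suc (suc a) x ⟩
      iter (suc a) (Φ x)    ≡⟨ cong (iter (suc a)) Φx ⟩
      iter (suc a) y        ≡⟨ ea ⟩
      pathMin y             ≡⟨ cong pathMin Φx ⟨
      pathMin (Φ x)         ≡⟨ proj₂ (Φ-path w≼x) ⟩
      pathMin x             ∎)
    where open ≡-Reasoning

  walk-down : ∀ {x} → w ≼ x → ∀ k {z} → climbs k (just (pathMin x)) ≡ just z → z ≼ x → iter k (pathMin x) ≡ z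
  walk-down w≼x zero refl z≼x = refl
  walk-down {x} w≼x (suc k) {z} e z≼x with climbs-parent {k} e
  ... | z₀ , e₀ , z₀↦z = step (pathStep w≼z₀)
    where
    spec : IsPathMin x (pathMin x)
    spec = pathMin-spec w≼x
    w≼z₀ : w ≼ z₀
    w≼z₀ = ≼-trans (proj₁ spec) (k , e₀)
    z₀≼x : z₀ ≼ x
    z₀≼x = ≼-trans (≼-parent z₀↦z) z≼x
    h≤z : pathMin x F.≤ z
    h≤z = proj₂ (proj₂ spec) z (≼-trans w≼z₀ (≼-parent z₀↦z)) z≼x
    same-min : pathMin z₀ ≡ pathMin x
    same-min = pathMin-unique (proj₁ spec , (k , e₀) , λ y w≼y y≼z₀ → proj₂ (proj₂ spec) y w≼y (≼-trans y≼z₀ z₀≼x))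
    step : PathStep z₀ → iter (suc k) (pathMin x) ≡ z
    step (close-at-root root _) = ⊥-elim (just≢nothing (trans (sym z₀↦z) root))
    step (close-before y z₀↦y y<h _) with trans (sym z₀↦z) z₀↦y
    ... | refl = ⊥-elim (ℕP.<-irrefl refl (ℕP.<-≤-trans y<h (subst (F._≤ z) (sym same-min) h≤z)))
    step (continue y z₀↦y _ Φz₀) with trans (sym z₀↦z) z₀↦y
    ... | refl = trans (cong Φ (walk-down w≼x k e₀ z₀≼x)) Φz₀

  path-cyclic : ∀ {x} → w ≼ x → Cyclic x × Reaches x (pathMin x)
  path-cyclic {x} w≼x with walk-up n (bounded x) w≼x | proj₁ (proj₂ (pathMin-spec w≼x))
  ... | a , ea | k , ek = (k + a , (begin
      iter (suc (k + a)) x       ≡⟨ cong (λ m → iter m x) (ℕP.+-suc k a) ⟨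
      iter (k + suc a) x         ≡⟨ iter-+ k (suc a) x ⟩
      iter k (iter (suc a) x)    ≡⟨ cong (iter k) ea ⟩
      iter k (pathMin x)         ≡⟨ walk-down w≼x k ek ≼-refl ⟩
      x                          ∎))
    , (suc a , ea)
    where open ≡-Reasoning

  orbit-on-path : ∀ {x} → w ≼ x → ∀ k → w ≼ iter k x × pathMin (iter k x) ≡ pathMin x
  orbit-on-path w≼x zero = w≼x , refl
  orbit-on-path w≼x (suc k) with orbit-on-path w≼x k
  ... | w≼y , hy = proj₁ (Φ-path w≼y) , trans (proj₂ (Φ-path w≼y)) hy

  orbitMin-path : ∀ {x} → w ≼ x → orbitMin x ≡ pathMin x
  orbitMin-path {x} w≼x = orbitMin-unique (proj₂ (path-cyclic w≼x) , minimal)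
    where
    minimal : ∀ y → Reaches x y → pathMin x F.≤ y
    minimal y (k , refl) = subst (F._≤ iter k x) (proj₂ (orbit-on-path w≼x k)) (pathMin≤ (proj₁ (orbit-on-path w≼x k)))

  orbit-off-path : ∀ {x} → ¬ w ≼ x → ∀ k → w ≼ iter k x ⊎ climbs k (just x) ≡ just (iter k x)
  orbit-off-path w⋠x zero = inj₂ refl
  orbit-off-path {x} w⋠x (suc k) with orbit-off-path w⋠x k
  ... | inj₁ w≼y = inj₁ (proj₁ (Φ-path w≼y))
  ... | inj₂ e with ≼-dec w (iter k x)
  ... | inj₁ w≼y = inj₁ (proj₁ (Φ-path w≼y))
  ... | inj₂ w⋠y = inj₂ (trans (climbs-suc k (just x)) (trans (cong up e) (Φ-off w⋠y)))

  cyclic⇒path : ∀ {x} → Cyclic x → w ≼ x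
  cyclic⇒path {x} (k , e) with ≼-dec w x
  ... | inj₁ w≼x = w≼x
  ... | inj₂ w⋠x with orbit-off-path w⋠x (suc k)
  ... | inj₁ w≼y = ⊥-elim (w⋠x (subst (w ≼_) e w≼y))
  ... | inj₂ e′  = ⊥-elim (acyclic x k (trans e′ (cong just e)))

  leader⇒record : ∀ {x} → isLeader x ≡ true → w ≼ x × pathMin x ≡ x
  leader⇒record l with isLeader-sound l
  ... | c , m = cyclic⇒path c , trans (sym (orbitMin-path (cyclic⇒path c))) m

  record⇒leader : ∀ {x} → w ≼ x → pathMin x ≡ x → isLeader x ≡ true
  record⇒leader w≼x m = isLeader-complete (proj₁ (path-cyclic w≼x) , trans (orbitMin-path w≼x) m)

  -- No record lies below the path minimum of the root: there Ψ removes the edge.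
  no-record-below : ∀ {x} → w ≼ x → parent x ≡ nothing → prevLeader (pathMin x) ≡ nothing
  no-record-below {x} w≼x root = greatest-none {P = λ b → isLeader b ∧ ⌊ b F.<? pathMin x ⌋}
    λ b → ∧-false λ lb b<h → below (leader⇒record lb) (⌊⌋-sound (b F.<? pathMin x) b<h)
    where
    minimal : ∀ y → w ≼ y → y ≼ x → pathMin x F.≤ y
    minimal = proj₂ (proj₂ (pathMin-spec w≼x))
    below : ∀ {b} → w ≼ b × pathMin b ≡ b → ¬ b F.< pathMin x
    below {b} (w≼b , _) b<h with ≼-linear w≼b w≼x
    ... | inj₁ b≼x = ℕP.<⇒≱ b<h (minimal b w≼b b≼x)
    ... | inj₂ x≼b with ≼-uncons x≼b
    ... | inj₁ refl = ℕP.<⇒≱ b<h (minimal b w≼b ≼-refl)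
    ... | inj₂ (_ , x↦c , _) = just≢nothing (trans (sym x↦c) root)

  next-record : ∀ {x y} → w ≼ x → parent x ≡ just y → y F.< pathMin x → prevLeader (pathMin x) ≡ just y
  next-record {x} {y} w≼x x↦y y<h =
    greatest-unique {P = λ b → isLeader b ∧ ⌊ b F.<? pathMin x ⌋}
      (∧-intro (record⇒leader w≼y y-record) (⌊⌋-complete (y F.<? pathMin x) y<h) , maximal)
    where
    minimal : ∀ y → w ≼ y → y ≼ x → pathMin x F.≤ y
    minimal = proj₂ (proj₂ (pathMin-spec w≼x))
    w≼y : w ≼ y
    w≼y = ≼-trans w≼x (≼-parent x↦y)
    y-record : pathMin y ≡ y
    y-record = pathMin-record w≼y λ z w≼z z≼y → case w≼z (≼-between w≼x x↦y w≼z z≼y)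
      where
      case : ∀ {z} → w ≼ z → z ≼ x ⊎ z ≡ y → y F.≤ z
      case {z} w≼z (inj₁ z≼x) = ℕP.<⇒≤ (ℕP.<-≤-trans y<h (minimal z w≼z z≼x))
      case _ (inj₂ refl) = ℕP.≤-refl
    record-below : ∀ {b} → w ≼ b × pathMin b ≡ b → b F.< pathMin x → b F.≤ y
    record-below {b} (w≼b , b-record) b<h with ≼-linear w≼b w≼x
    ... | inj₁ b≼x = ⊥-elim (ℕP.<⇒≱ b<h (minimal b w≼b b≼x))
    ... | inj₂ x≼b with ≼-uncons x≼b
    ... | inj₁ refl = ⊥-elim (ℕP.<⇒≱ b<h (minimal b w≼b ≼-refl))
    ... | inj₂ (c , x↦c , c≼b) with trans (sym x↦y) x↦c
    ... | refl = subst (F._≤ c) b-record (proj₂ (proj₂ (pathMin-spec w≼b)) c w≼y c≼b)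
    maximal : ∀ b → (isLeader b ∧ ⌊ b F.<? pathMin x ⌋) ≡ true → b F.≤ y
    maximal b e = record-below (leader⇒record (proj₁ both)) (⌊⌋-sound (b F.<? pathMin x) (proj₂ both))
      where
      both : isLeader b ≡ true × ⌊ b F.<? pathMin x ⌋ ≡ true
      both = ∧-elim {isLeader b} e

  ΨΦ-parent : ∀ x → parentΨ x ≡ parent x
  ΨΦ-parent x with parentΨ-view x
  ... | acyclic-edge ¬c e = trans e (sym (Φ-off λ w≼x → ¬c (proj₁ (path-cyclic w≼x))))
  ... | cycle-edge c not-leader e = closing (pathStep (cyclic⇒path c))
    where
    w≼x : w ≼ x
    w≼x = cyclic⇒path c
    min-leader : isLeader (pathMin x) ≡ true
    min-leader = record⇒leader (proj₁ (pathMin-spec w≼x)) (pathMin-idem w≼x)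
    Φx≢min : Φ x ≢ pathMin x
    Φx≢min Φx = true≢false (trans (sym min-leader) (trans (cong isLeader (sym Φx)) not-leader))
    closing : PathStep x → parentΨ x ≡ parent x
    closing (close-at-root _ Φx)    = ⊥-elim (Φx≢min Φx)
    closing (close-before _ _ _ Φx) = ⊥-elim (Φx≢min Φx)
    closing (continue y x↦y _ Φx) = trans e (trans (cong just Φx) (sym x↦y))
  ... | redirected c leader e = closing (pathStep (cyclic⇒path c))
    where
    w≼x : w ≼ x
    w≼x = cyclic⇒path c
    closing : PathStep x → parentΨ x ≡ parent x
    closing (close-at-root root Φx) = trans e (trans (cong prevLeader Φx) (trans (no-record-below w≼x root) (sym root)))
    closing (close-before y x↦y y<h Φx) = trans e (trans (cong prevLeader Φx) (trans (next-record w≼x x↦y y<h) (sym x↦y)))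
    closing (continue y x↦y _ Φx) = ⊥-elim (parent-irrefl (trans x↦y (cong just (≼-antisym y≼x x≼y))))
      where
      x≼y : x ≼ y
      x≼y = ≼-parent x↦y
      y≡h : y ≡ pathMin x
      y≡h = trans (sym (proj₂ (leader⇒record (subst (λ z → isLeader z ≡ true) Φx leader))))
                  (trans (cong pathMin (sym Φx)) (proj₂ (Φ-path w≼x)))
      y≼x : y ≼ x
      y≼x = subst (_≼ x) (sym y≡h) (proj₁ (proj₂ (pathMin-spec w≼x)))

  ΨΦ-mark : ∀ d → markΨ d ≡ w
  ΨΦ-mark d = cong (fromMaybe d) (greatest-unique {P = isLeader} (record⇒leader ≼-refl w-record , maximal))
    where
    w-record : pathMin w ≡ w
    w-record = pathMin-record ≼-refl λ z w≼z z≼w → FP.≤-reflexive (≼-antisym w≼z z≼w)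
    maximal : ∀ b → isLeader b ≡ true → b F.≤ w
    maximal b lb = subst (F._≤ w) (proj₂ b-record) (proj₂ (proj₂ (pathMin-spec (proj₁ b-record))) w ≼-refl (proj₁ b-record))
      where
      b-record : w ≼ b × pathMin b ≡ b
      b-record = leader⇒record lb

  -- Only the path edge into v changes, and
  -- its new source is either its old source or, when v is a path minimum
  -- closing a cycle, a node of that cycle, hence ≥ v.
  children-above⇒preimages-above : ∀ v → (∀ i → parent i ≡ just v → v F.< i) → ∀ i → Φ i ≡ v → v F.≤ i
  children-above⇒preimages-above v above i Φi with ≼-dec w i
  ... | inj₂ w⋠i = ℕP.<⇒≤ (above i (trans (Φ-off w⋠i) (cong just Φi)))
  ... | inj₁ w≼i with pathStep w≼i
  ... | close-at-root _ Φi′       = subst (F._≤ i) (trans (sym Φi′) Φi) (pathMin≤ w≼i)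
  ... | close-before _ _ _ Φi′    = subst (F._≤ i) (trans (sym Φi′) Φi) (pathMin≤ w≼i)
  ... | continue _ i↦y _ Φi′      = ℕP.<⇒≤ (above i (trans i↦y (cong just (trans (sym Φi′) Φi))))

  preimages-above⇒children-above : ∀ v → (∀ i → Φ i ≡ v → v F.≤ i) → ∀ i → parent i ≡ just v → v F.< i
  preimages-above⇒children-above v above i i↦v = FP.≤∧≢⇒< (v≤i (≼-dec w i)) v≢i
    where
    v≢i : v ≢ i
    v≢i refl = parent-irrefl i↦v
    v≤i : w ≼ i ⊎ ¬ w ≼ i → v F.≤ i
    v≤i (inj₂ w⋠i) = above i (just-injective (trans (sym (Φ-off w⋠i)) i↦v))
    v≤i (inj₁ w≼i) with pathStep w≼i
    ... | close-at-root root _ = ⊥-elim (just≢nothing (trans (sym i↦v) root))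
    ... | close-before y i↦y y<h _ with trans (sym i↦v) i↦y
    ... | refl = ℕP.<⇒≤ (ℕP.<-≤-trans y<h (pathMin≤ w≼i))
    v≤i (inj₁ w≼i) | continue y i↦y _ Φi with trans (sym i↦v) i↦y
    ... | refl = above i Φi

  runs-agree : (e : isCayley P ≡ true) (F : Mapping n) → (∀ i → lookup F i ≡ Φ i) → treeRuns (P , e) ≡ mapRuns F
  runs-agree e F F≗Φ = count-cong λ v → bool-ext (tree⇒map v) (map⇒tree v)
    where
    tree⇒map : ∀ v → allF (λ i → if isChildOf P i v then ⌊ v F.<? i ⌋ else true) ≡ true →
                     allF (λ i → if ⌊ lookup F i F.≟ v ⌋ then ⌊ v F.≤? i ⌋ else true) ≡ true
    tree⇒map v t = allF-intro λ i → implies-intro λ Fi≡v →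
      ⌊⌋-complete (v F.≤? i)
        (children-above⇒preimages-above v above i (trans (sym (F≗Φ i)) (⌊⌋-sound (lookup F i F.≟ v) Fi≡v)))
      where
      above : ∀ i → parent i ≡ just v → v F.< i
      above i i↦v = ⌊⌋-sound (v F.<? i) (implies-elim (allF-elim t i) (isChildOf-complete P i↦v))
    map⇒tree : ∀ v → allF (λ i → if ⌊ lookup F i F.≟ v ⌋ then ⌊ v F.≤? i ⌋ else true) ≡ true →
                     allF (λ i → if isChildOf P i v then ⌊ v F.<? i ⌋ else true) ≡ true
    map⇒tree v m = allF-intro λ i → implies-intro λ child →
      ⌊⌋-complete (v F.<? i) (preimages-above⇒children-above v above i (isChildOf-sound P child))
      where
      above : ∀ i → Φ i ≡ v → v F.≤ i
      above i Φi = ⌊⌋-sound (v F.≤? i) (implies-elim (allF-elim m i) (⌊⌋-complete (lookup F i F.≟ v) (trans (F≗Φ i) Φi)))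

-- The path from the marked node (the greatest leader) runs through the cycles
-- of f in decreasing order of their leaders, each cycle traversed from its
-- leader along f; the node before the least leader is the root.  `default`
-- is any element of Fin n, needed only to witness n ≥ 1.
module MappingToTree {n : ℕ} (F : Mapping n) (default : Fin n) where

  f : Fin n → Fin n
  f = lookup F

  open CycleStructure f public

  T : ParentMap n
  T = tabulate parentΨ

  open Ancestry T public

  parent≡parentΨ : ∀ x → parent x ≡ parentΨ x
  parent≡parentΨ = lookup∘tabulate parentΨ

  parentΨ→parent : ∀ {x m} → parentΨ x ≡ m → parent x ≡ m
  parentΨ→parent {x} = trans (parent≡parentΨ x)

  parent→parentΨ : ∀ {x m} → parent x ≡ m → parentΨ x ≡ m
  parent→parentΨ {x} = trans (sym (parent≡parentΨ x))

  cyclic-dec : ∀ x → Cyclic x ⊎ ¬ Cyclic x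
  cyclic-dec x with cyclic? x in e
  ... | true  = inj₁ (cyclic?-sound e)
  ... | false = inj₂ (cyclic?-false e)

  -- Climbing T from a cyclic point x only meets cyclic points and never
  -- increases the cycle minimum; while it stays on the cycle of x it follows
  -- f and has not crossed an edge entering a leader.
  OnCycleClimb : Fin n → ℕ → Fin n → Set
  OnCycleClimb x k y = iter k x ≡ y × (∀ j → j < k → isLeader (f (iter j x)) ≡ false)

  ClimbInvariant : Fin n → ℕ → Fin n → Set
  ClimbInvariant x k y = Cyclic y × orbitMin y F.≤ orbitMin x × (orbitMin y ≡ orbitMin x → OnCycleClimb x k y)

  climb-cyclic : ∀ {x} → Cyclic x → ∀ k {y} → climbs k (just x) ≡ just y → ClimbInvariant x k y
  climb-cyclic c zero refl = c , ℕP.≤-refl , λ _ → refl , λ _ ()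
  climb-cyclic {x} c (suc k) {y} e with climbs-parent {k} e
  ... | y₀ , e₀ , y₀↦y with climb-cyclic c k e₀
  ... | c₀ , le₀ , same₀ = step (parentΨ-view y₀)
    where
    edge : parentΨ y₀ ≡ just y
    edge = parent→parentΨ y₀↦y
    step : ParentΨView y₀ → ClimbInvariant x (suc k) y
    step (acyclic-edge ¬c₀ _) = ⊥-elim (¬c₀ c₀)
    step (cycle-edge _ not-leader e₁) with trans (sym edge) e₁
    ... | refl = Cyclic-f c₀ , subst (F._≤ orbitMin x) (sym (orbitMin-f c₀)) le₀ , on-cycle
      where
      on-cycle : orbitMin (f y₀) ≡ orbitMin x → OnCycleClimb x (suc k) (f y₀)
      on-cycle same with same₀ (trans (sym (orbitMin-f c₀)) same)
      ... | reach , no-leader = cong f reach , earlier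
        where
        earlier : ∀ j → j < suc k → isLeader (f (iter j x)) ≡ false
        earlier j j<k+1 with j ℕ.≟ k
        ... | yes refl = subst (λ z → isLeader (f z) ≡ false) (sym reach) not-leader
        ... | no  j≢k  = no-leader j (ℕP.≤∧≢⇒< (ℕ.s≤s⁻¹ j<k+1) j≢k)
    step (redirected _ leader e₁) with prevLeader-sound (trans (sym e₁) edge)
    ... | ly , y<fy₀ = proj₁ (isLeader-sound ly) , ℕP.<⇒≤ drop , λ same → ⊥-elim (FP.<-irrefl same drop)
      where
      drop : orbitMin y F.< orbitMin x
      drop = subst (F._< orbitMin x) (sym (leader-fixed ly))
               (ℕP.<-≤-trans (subst (y F.<_) (trans (sym (leader-fixed leader)) (orbitMin-f c₀)) y<fy₀) le₀)

  climb-acyclic : ∀ {x} → ¬ Cyclic x → ∀ k {y} → climbs k (just x) ≡ just y → iter k x ≡ y ⊎ Cyclic y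
  climb-acyclic ¬c zero refl = inj₁ refl
  climb-acyclic {x} ¬c (suc k) {y} e with climbs-parent {k} e
  ... | y₀ , e₀ , y₀↦y = step (climb-acyclic ¬c k e₀) (parentΨ-view y₀)
    where
    step : iter k x ≡ y₀ ⊎ Cyclic y₀ → ParentΨView y₀ → iter (suc k) x ≡ y ⊎ Cyclic y
    step _         (cycle-edge c₀ _ _) = inj₂ (proj₁ (climb-cyclic c₀ 1 y₀↦y))
    step _         (redirected c₀ _ _) = inj₂ (proj₁ (climb-cyclic c₀ 1 y₀↦y))
    step (inj₂ c₀) (acyclic-edge _ _)  = inj₂ (proj₁ (climb-cyclic c₀ 1 y₀↦y))
    step (inj₁ reach) (acyclic-edge _ e₁) =
      inj₁ (trans (cong f reach) (just-injective (trans (sym e₁) (parent→parentΨ y₀↦y))))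

  -- T has no cycles: a cycle of T through a cyclic x would run once around
  -- the cycle of f without entering its leader.
  T-acyclic : Acyclic
  T-acyclic x k e with cyclic-dec x
  ... | inj₂ ¬c with climb-acyclic ¬c (suc k) e
  ... | inj₁ returns = ¬c (k , returns)
  ... | inj₂ c       = ¬c c
  T-acyclic x k e | inj₁ c with proj₂ (proj₂ (climb-cyclic c (suc k) e)) refl
  ... | returns , no-leader with enters-leader returns
  ... | j , j<k+1 , entry =
        true≢false (trans (sym (leader-orbitMin c)) (trans (cong isLeader (sym entry)) (no-leader j j<k+1)))

  T-bounded : ∀ x → climbs n (just x) ≡ nothing
  T-bounded = acyclic⇒bounded T-acyclic

  root-shape : ∀ {x} → parent x ≡ nothing → Cyclic x × isLeader (f x) ≡ true × prevLeader (f x) ≡ nothing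
  root-shape {x} root with parentΨ-view x
  ... | acyclic-edge _ e   = ⊥-elim (just≢nothing (trans (sym e) (parent→parentΨ root)))
  ... | cycle-edge _ _ e   = ⊥-elim (just≢nothing (trans (sym e) (parent→parentΨ root)))
  ... | redirected c l e   = c , l , trans (sym e) (parent→parentΨ root)

  -- Two roots enter the least leader, hence are equal as f is injective on cycles.
  T-root-unique : ∀ a b → parent a ≡ nothing → parent b ≡ nothing → a ≡ b
  T-root-unique a b ra rb with root-shape ra | root-shape rb
  ... | ca , la , none-a | cb , lb , none-b =
        cyclic-injective ca cb (FP.≤-antisym (ℕP.≮⇒≥ (prevLeader-none none-a lb)) (ℕP.≮⇒≥ (prevLeader-none none-b la)))

  leader-entry : ∀ {m} → isLeader m ≡ true → ∃ λ x → Reaches m x × parent x ≡ prevLeader m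
  leader-entry {m} l with isLeader-sound l
  ... | (k , returns) , _ = iter k m , (k , refl) , entry (parentΨ-view (iter k m))
    where
    entry : ParentΨView (iter k m) → parent (iter k m) ≡ prevLeader m
    entry (acyclic-edge ¬c _)  = ⊥-elim (¬c (Cyclic-iter (k , returns) k))
    entry (cycle-edge _ nl _)  = ⊥-elim (true≢false (trans (sym l) (trans (cong isLeader (sym returns)) nl)))
    entry (redirected _ _ e)   = parentΨ→parent (trans e (cong prevLeader returns))

  -- Since n ≥ 1, f has a cycle and hence a leader.
  some-leader : ∃ λ m → isLeader m ≡ true
  some-leader with repeat-within default
  ... | i , zero  , () , _
  ... | i , suc d , _  , _ , e = orbitMin (iter i default) , leader-orbitMin (d , returns)
    where
    returns : iter (suc d) (iter i default) ≡ iter i default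
    returns = trans (sym (iter-+ (suc d) i default)) (trans (cong (λ m → iter m default) (ℕP.+-comm (suc d) i)) e)

  -- The root is entered from the cycle of the least leader.
  T-root : ∃ λ r → parent r ≡ nothing
  T-root with least-spec {P = isLeader} (proj₁ some-leader) (proj₂ some-leader)
  ... | m₀ , _ , (l₀ , least-leader) with leader-entry l₀
  ... | x , _ , x↦ = x , trans x↦ (greatest-none {P = λ y → isLeader y ∧ ⌊ y F.<? m₀ ⌋} λ b →
        ∧-false λ lb b<m₀ → ℕP.<⇒≱ (⌊⌋-sound (b F.<? m₀) b<m₀) (least-leader b lb))

  T-cayley : isCayley T ≡ true
  T-cayley = cayley-intro T (proj₁ T-root) (proj₂ T-root) T-root-unique T-bounded

  climb-from-leader : ∀ {m} → isLeader m ≡ true → ∀ j → (∀ i → i < j → iter (suc i) m ≢ m) →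
                      climbs j (just m) ≡ just (iter j m)
  climb-from-leader l zero _ = refl
  climb-from-leader {m} l (suc j) no-return =
    trans (climbs-suc j (just m)) (trans (cong up (climb-from-leader l j (λ i i<j → no-return i (ℕP.m<n⇒m<1+n i<j))))
                                         (step (parentΨ-view (iter j m))))
    where
    step : ParentΨView (iter j m) → parent (iter j m) ≡ just (iter (suc j) m)
    step (acyclic-edge ¬c _) = ⊥-elim (¬c (Cyclic-iter (proj₁ (isLeader-sound l)) j))
    step (cycle-edge _ _ e)  = parentΨ→parent e
    step (redirected _ l′ _) = ⊥-elim (no-return j (ℕP.n<1+n j) (leader-unique l (suc j , refl) l′))

  cycle-above-leader : ∀ {m x} → isLeader m ≡ true → Reaches m x → m ≼ x
  cycle-above-leader l r with first-visit r
  ... | j , reach , no-return = j , trans (climb-from-leader l j no-return) (cong just reach)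

  module FromGreatestLeader (g : Fin n) (g-greatest : IsGreatest isLeader g) where

    -- Every leader m < g lies above the least leader m′ greater than m: the
    -- edge entering m′ is redirected to m.
    next-leader-above : ∀ {m} → isLeader m ≡ true → m ≢ g → ∃ λ m′ → isLeader m′ ≡ true × m F.< m′ × m′ ≼ m
    next-leader-above {m} l m≢g = successor (least-spec {P = Above} g g-above)
      where
      Above : Fin n → Bool
      Above y = isLeader y ∧ ⌊ m F.<? y ⌋
      g-above : Above g ≡ true
      g-above = ∧-intro (proj₁ g-greatest) (⌊⌋-complete (m F.<? g) (FP.≤∧≢⇒< (proj₂ g-greatest m l) m≢g))
      successor : (∃ λ m′ → least Above ≡ just m′ × IsLeast Above m′) →
                  ∃ λ m′ → isLeader m′ ≡ true × m F.< m′ × m′ ≼ m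
      successor (m′ , _ , above , least-above) =
        let (l′ , m<?m′) = ∧-elim {isLeader m′} above
            m<m′ : m F.< m′
            m<m′ = ⌊⌋-sound (m F.<? m′) m<?m′
            (x , r , x↦) = leader-entry l′
            prev : prevLeader m′ ≡ just m
            prev = prevLeader-successor l m<m′ λ b lb m<b → least-above b (∧-intro lb (⌊⌋-complete (m F.<? b) m<b))
        in m′ , l′ , m<m′ , ≼-trans (cycle-above-leader l′ r) (≼-parent (trans x↦ prev))

    -- Every leader lies on the path from g; induction on t ≥ g − m.
    leader-on-path : ∀ t {m} → isLeader m ≡ true → toℕ g ≤ toℕ m + t → g ≼ m
    leader-on-path zero {m} l le =
      subst (g ≼_) (FP.≤-antisym (subst (toℕ g ≤_) (ℕP.+-identityʳ _) le) (proj₂ g-greatest m l)) ≼-refl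
    leader-on-path (suc t) {m} l le = by-cases (m F.≟ g)
      where
      by-cases : Dec (m ≡ g) → g ≼ m
      by-cases (yes refl) = ≼-refl
      by-cases (no m≢g) =
        let (m′ , l′ , m<m′ , m′≼m) = next-leader-above l m≢g
            le′ : toℕ g ≤ toℕ m′ + t
            le′ = ℕP.≤-trans le (subst (_≤ toℕ m′ + t) (sym (ℕP.+-suc (toℕ m) t)) (ℕP.+-monoˡ-≤ t m<m′))
        in ≼-trans (leader-on-path t l′ le′) m′≼m

    cyclic⇒on-path : ∀ {x} → Cyclic x → g ≼ x
    cyclic⇒on-path {x} c = ≼-trans (leader-on-path (toℕ g) l (ℕP.m≤n+m (toℕ g) _))
                                      (cycle-above-leader l (Reaches-sym c (proj₁ (orbitMin-spec x))))
      where
      l : isLeader (orbitMin x) ≡ true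
      l = leader-orbitMin c

    on-path⇒cyclic : ∀ {x} → g ≼ x → Cyclic x
    on-path⇒cyclic (k , e) = proj₁ (climb-cyclic (proj₁ (isLeader-sound (proj₁ g-greatest))) k e)

    module ΦT = TreeToMapping T T-bounded T-root-unique g

    pathMin≡orbitMin : ∀ {x} → Cyclic x → ΦT.pathMin x ≡ orbitMin x
    pathMin≡orbitMin {x} c =
      ΦT.pathMin-unique (cyclic⇒on-path (Cyclic-reach c r) , cycle-above-leader l (Reaches-sym c r) , minimal)
      where
      r : Reaches x (orbitMin x)
      r = proj₁ (orbitMin-spec x)
      l : isLeader (orbitMin x) ≡ true
      l = leader-orbitMin c
      minimal : ∀ y → g ≼ y → y ≼ x → orbitMin x F.≤ y
      minimal y g≼y (k , e) = ℕP.≤-trans (proj₁ (proj₂ (climb-cyclic (on-path⇒cyclic g≼y) k e))) (orbitMin≤ y)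

    ΦΨ : ∀ x → ΦT.Φ x ≡ f x
    ΦΨ x = by-position (ΦT.≼-dec g x) (parentΨ-view x)
      where
      h≡fx : Cyclic x → isLeader (f x) ≡ true → ΦT.pathMin x ≡ f x
      h≡fx c l = trans (pathMin≡orbitMin c) (trans (sym (orbitMin-f c)) (leader-fixed l))
      h≤fx : Cyclic x → ΦT.pathMin x F.≤ f x
      h≤fx c = subst (F._≤ f x) (trans (orbitMin-f c) (sym (pathMin≡orbitMin c))) (orbitMin≤ (f x))
      along-path : Cyclic x → ΦT.PathStep x → ParentΨView x → ΦT.Φ x ≡ f x
      along-path c _ (acyclic-edge ¬c _) = ⊥-elim (¬c c)
      along-path c (ΦT.close-at-root root _) (cycle-edge _ _ e) = ⊥-elim (just≢nothing (trans (sym (parentΨ→parent e)) root))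
      along-path c (ΦT.close-at-root _ Φx) (redirected _ l _) = trans Φx (h≡fx c l)
      along-path c (ΦT.close-before y x↦y y<h _) (cycle-edge _ _ e) =
        ⊥-elim (ℕP.<⇒≱ y<h (subst (ΦT.pathMin x F.≤_) (just-injective (trans (sym (parentΨ→parent e)) x↦y)) (h≤fx c)))
      along-path c (ΦT.close-before _ _ _ Φx) (redirected _ l _) = trans Φx (h≡fx c l)
      along-path c (ΦT.continue y x↦y _ Φx) (cycle-edge _ _ e) = trans Φx (just-injective (trans (sym x↦y) (parentΨ→parent e)))
      along-path c (ΦT.continue y x↦y y≮h _) (redirected _ l e) =
        ⊥-elim (y≮h (subst (y F.<_) (sym (h≡fx c l)) (proj₂ (prevLeader-sound (trans (sym e) (parent→parentΨ x↦y))))))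
      by-position : g ≼ x ⊎ ¬ g ≼ x → ParentΨView x → ΦT.Φ x ≡ f x
      by-position (inj₁ g≼x) v = along-path (on-path⇒cyclic g≼x) (ΦT.pathStep g≼x) v
      by-position (inj₂ g⋠x) (acyclic-edge _ e) = just-injective (trans (sym (ΦT.Φ-off g⋠x)) (parentΨ→parent e))
      by-position (inj₂ g⋠x) (cycle-edge c _ _) = ⊥-elim (g⋠x (cyclic⇒on-path c))
      by-position (inj₂ g⋠x) (redirected c _ _) = ⊥-elim (g⋠x (cyclic⇒on-path c))

  mark : Fin n
  mark = markΨ default

  mark-greatest : IsGreatest isLeader mark
  mark-greatest with greatest-spec {P = isLeader} (proj₁ some-leader) (proj₂ some-leader)
  ... | g , e , spec rewrite e = spec

Σ-≡-irrelevant : ∀ {A : Set} {B : A → Set} → (∀ {a} → Irrelevant (B a)) →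
                 ∀ {a a′ : A} {b : B a} {b′ : B a′} → a ≡ a′ → (a , b) ≡ (a′ , b′)
Σ-≡-irrelevant irr {b = b} {b′} refl = cong (_ ,_) (irr b b′)

-- The runs
-- equations and the Cayley condition are proofs in sets with decidable
-- equality, so only the underlying data need to be compared.
module Bijection (n m : ℕ) (n≥1 : n ≥ 1) where

  default : Fin n
  default = F.fromℕ< n≥1

  MarkedTrees : Set
  MarkedTrees = Σ (CayleyTree n) (λ T → treeRuns T ≡ m) × Fin n

  Mappings : Set
  Mappings = Σ (Mapping n) (λ f → mapRuns f ≡ m)

  module Φ-of (P : ParentMap n) (cayley : isCayley P ≡ true) =
    TreeToMapping P (cayley-bounded P cayley) (cayley-root-unique P cayley)

  toMapping : MarkedTrees → Mappings
  toMapping (((P , cayley) , runs) , w) =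
    tabulate Φ , trans (sym (runs-agree cayley (tabulate Φ) (lookup∘tabulate Φ))) runs
    where open Φ-of P cayley w

  toTree : Mappings → MarkedTrees
  toTree (F , runs) =
    ((T , T-cayley) , trans (ΦT.runs-agree T-cayley F (λ i → sym (ΦΨ i))) runs) , mark
    where
    open MappingToTree F default
    open FromGreatestLeader mark mark-greatest

  to∘from : ∀ y → toMapping (toTree y) ≡ y
  to∘from (F , _) = Σ-≡-irrelevant ℕP.≡-irrelevant
    (trans (tabulate-cong ΦΨ) (tabulate∘lookup F))
    where
    open MappingToTree F default
    open FromGreatestLeader mark mark-greatest

  from∘to : ∀ x → toTree (toMapping x) ≡ x
  from∘to (((P , cayley) , _) , w) =
    cong₂ _,_ (Σ-≡-irrelevant ℕP.≡-irrelevant (Σ-≡-irrelevant (Decidable⇒UIP.≡-irrelevant Bool._≟_) same-tree))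
              same-mark
    where
    open Φ-of P cayley w
    Φ≗ : ∀ i → lookup (tabulate Φ) i ≡ Φ i
    Φ≗ = lookup∘tabulate Φ
    same-tree : tabulate (MappingToTree.parentΨ (tabulate Φ) default) ≡ P
    same-tree = trans (tabulate-cong λ x → trans (parentΨ-cong Φ≗ x) (ΨΦ-parent x)) (tabulate∘lookup P)
    same-mark : MappingToTree.mark (tabulate Φ) default ≡ w
    same-mark = trans (markΨ-cong Φ≗ default) (ΨΦ-mark default)

  bijection : MarkedTrees ⤖ Mappings
  bijection = ↔⇒⤖ (mk↔ₛ′ toMapping toTree to∘from from∘to)

mainTheorem4 : (n m : ℕ) → n ≥ 1 → m ≥ 1 →
    (Σ (CayleyTree n) (λ T → treeRuns T ≡ m) × Fin n) ⤖ Σ (Mapping n) (λ f → mapRuns f ≡ m)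
mainTheorem4 n m n≥1 _ = Bijection.bijection n m n≥1
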